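{- Let $k \ge 1$ and $r \geq 2$ be integers. Let $F$ be a finite field of characteristic 2 and let $X \subseteq F$ with $|X| = 2k+r$ such that $e_{2m+1}(X) = 0_F$ for every nonnegative integer $m$ with $2m+1 \leq r$. Define $f(A) = (e_1(A), \ldots, e_r(A)) \in F^r$ for $k$-element subsets $A$ of $F$. If $A$ and $B$ are disjoint subsets of $X$ with $|A| = |B| = k$, then $f(A) \neq f(B)$.
   Context: For a finite subset $Z = \{z_1,\ldots,z_n\}$ of a field $F$ and an integer $i \ge 0$, $e_i(Z) = \sum_{1 \le t_1 < \cdots < t_i \le n} z_{t_1}\cdots z_{t_i}$ (the $i$-th elementary symmetric polynomial of the elements of $Z$), with $e_0(Z)=1_F$ and $e_i(Z)=0_F$ if $i>|Z|$. -}

module Defs where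

open import Level using (Level; _⊔_)
open import Data.Nat using (ℕ; zero; suc)
open import Data.List using (List; []; _∷_)
open import Data.Vec using (Vec; tabulate)
open import Data.Fin using (Fin; toℕ)
open import Data.Product using (Σ; ∃; _×_)
open import Relation.Nullary using (¬_)
open import Relation.Binary.Definitions using (Decidable)
open import Algebra.Bundles using (CommutativeRing)
import Data.List.Membership.Setoid as SetoidMembership

record IsField {c ℓ : Level} (R : CommutativeRing c ℓ) : Set (c ⊔ ℓ) where
  open CommutativeRing R
  field
    1≉0     : ¬ (1# ≈ 0#)
    inverse : ∀ x → ¬ (x ≈ 0#) → Σ Carrier (λ y → (x * y) ≈ 1#)

record FiniteField (c ℓ : Level) : Set (Level.suc (c ⊔ ℓ)) where
  field
    cring   : CommutativeRing c ℓ
    isField : IsField cring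
  open CommutativeRing cring public hiding (ring)
  open SetoidMembership setoid using (_∈_)
  field
    _≟_      : Decidable _≈_
    elements : List Carrier
    complete : ∀ x → x ∈ elements

HasChar2 : ∀ {c ℓ} → FiniteField c ℓ → Set ℓ
HasChar2 F = (1# + 1#) ≈ 0#
  where open FiniteField F

module _ {c ℓ} (F : FiniteField c ℓ) where
  open FiniteField F

  -- elementary symmetric polynomial e_i of the elements of a list
  -- (for a duplicate-free list this is e_i of the corresponding set):
  -- e_0 = 1, e_{i+1}([]) = 0, e_{i+1}(z ∷ Z) = e_{i+1}(Z) + z * e_i(Z)
  e : ℕ → List Carrier → Carrier
  e zero    _       = 1#
  e (suc i) []      = 0#
  e (suc i) (z ∷ Z) = e (suc i) Z + z * e i Z

  f : (r : ℕ) → List Carrier → Vec Carrier r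
  f r A = tabulate (λ (j : Fin r) → e (suc (toℕ j)) A)

module Submission where

-- Write X = A ∪ B ∪ C and e(Y) := ∏_{y ∈ Y} (1 + y t) = Σ_i e_i(Y) tⁱ ∈ F[[t]], so that
-- e(X) = e(A) e(B) e(C). If f(A) = f(B), then e(X) agrees up to degree r with e(A)² e(C), and in
-- characteristic 2, e(A)² = ∏_{a ∈ A} (1 + a² t²) is even. Dividing it out factor by factor, the
-- odd coefficients of e(C) vanish up to degree r = |C|, hence all of them. That is impossible
-- for r ≥ 2 distinct elements: for c ∈ C nonzero and D = C ∖ {c}, it forces
-- e_{2m+1}(D) = c e_{2m}(D), which makes c a root of ∏_{d ∈ D} (x + d).

open import Defs
open import Level using (Level)
open import Algebra.Bundles using (CommutativeRing)
open import Data.Nat using (ℕ; zero; suc; _≤_; _<_; z≤n; s≤s; _≤?_)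
import Data.Nat as ℕ
import Data.Nat.Properties as ℕ
open import Data.Maybe using (nothing)
open import Relation.Binary.PropositionalEquality as ≡ using (_≡_)
open import Relation.Nullary using (¬_; yes; no)
open import Tactic.RingSolver using (solve-∀)
open import Tactic.RingSolver.Core.AlmostCommutativeRing
  using (AlmostCommutativeRing; fromCommutativeRing)

double : ℕ → ℕ
double zero    = zero
double (suc m) = suc (suc (double m))

1+double≡2*+1 : ∀ m → suc (double m) ≡ 2 ℕ.* m ℕ.+ 1
1+double≡2*+1 zero    = ≡.refl
1+double≡2*+1 (suc m) = ≡.trans (≡.cong (λ n → suc (suc n)) (1+double≡2*+1 m))
                                (≡.sym (≡.cong (ℕ._+ 1) (ℕ.*-suc 2 m)))

double≡n+n : ∀ n → double n ≡ n ℕ.+ n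
double≡n+n zero    = ≡.refl
double≡n+n (suc m) = ≡.cong suc (≡.trans (≡.cong suc (double≡n+n m)) (≡.sym (ℕ.+-suc m m)))

module RingIdentities {c ℓ} (R : CommutativeRing c ℓ) where
  private
    R′ : AlmostCommutativeRing c ℓ
    R′ = fromCommutativeRing R (λ _ → nothing)
  open AlmostCommutativeRing R′

  linear-comm₁ : ∀ a b p q → (p + b * q) + a * q ≈ (p + a * q) + b * q
  linear-comm₁ = solve-∀ R′

  linear-comm₂ : ∀ a b p q s → (p + b * q) + a * (q + b * s) ≈ (p + a * q) + b * (q + a * s)
  linear-comm₂ = solve-∀ R′

  +-shuffle : ∀ p y w → (p + y) + (y + w) ≈ (p + w) + (y + y)
  +-shuffle = solve-∀ R′

  horner-linear₀ : ∀ x d p q → x * p + (q + d * p) ≈ (x + d) * p + q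
  horner-linear₀ = solve-∀ R′

  horner-linear : ∀ x d h p q → x * ((x + d) * h + p) + (q + d * p) ≈ (x + d) * (x * h + p) + q
  horner-linear = solve-∀ R′

module PowerSeries {c ℓ} (R : CommutativeRing c ℓ) where
  open CommutativeRing R hiding (zero)
  open RingIdentities R
  open import Relation.Binary.Reasoning.Setoid setoid
  open import Algebra.Properties.CommutativeSemigroup +-commutativeSemigroup
    using (interchange)

  Series : Set c
  Series = ℕ → Carrier

  private
    variable
      a b x : Carrier
      p p′ q q′ : Series

  infix 4 _≋_
  _≋_ : Series → Series → Set ℓ
  p ≋ q = ∀ n → p n ≈ q n

  AgreeUpTo : ℕ → Series → Series → Set ℓ
  AgreeUpTo n p q = ∀ i → i ≤ n → p i ≈ q i

  OddVanishingUpTo : ℕ → Series → Set ℓ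
  OddVanishingUpTo r p = ∀ m → suc (double m) ≤ r → p (suc (double m)) ≈ 0#

  OddVanishing : Series → Set ℓ
  OddVanishing p = ∀ m → p (suc (double m)) ≈ 0#

  oddVanishingUpTo-2*+1 : ∀ {r} → (∀ m → 2 ℕ.* m ℕ.+ 1 ≤ r → p (2 ℕ.* m ℕ.+ 1) ≈ 0#) → OddVanishingUpTo r p
  oddVanishingUpTo-2*+1 odd-vanish m le with suc (double m) | 1+double≡2*+1 m
  ... | _ | ≡.refl = odd-vanish m le

  oddVanishingUpTo-resp : ∀ {r} → AgreeUpTo r p q → OddVanishingUpTo r p → OddVanishingUpTo r q
  oddVanishingUpTo-resp p≈q p-odd m le = trans (sym (p≈q _ le)) (p-odd m le)

  -- (1 + a t) · p
  mulLinear : Carrier → Series → Series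
  mulLinear a p zero    = p zero
  mulLinear a p (suc n) = p (suc n) + a * p n

  mulLinear-cong : a ≈ b → p ≋ q → mulLinear a p ≋ mulLinear b q
  mulLinear-cong a≈b p≈q zero    = p≈q zero
  mulLinear-cong a≈b p≈q (suc n) = +-cong (p≈q (suc n)) (*-cong a≈b (p≈q n))

  mulLinear-comm : ∀ a b p → mulLinear a (mulLinear b p) ≋ mulLinear b (mulLinear a p)
  mulLinear-comm a b p zero          = refl
  mulLinear-comm a b p (suc zero)    = linear-comm₁ a b (p 1) (p 0)
  mulLinear-comm a b p (suc (suc n)) = linear-comm₂ a b (p (suc (suc n))) (p (suc n)) (p n)

  shift : Series → Series
  shift p n = p (suc n)

  -- Cauchy product: (p ⋆ q) n = Σ_{i + j = n} p i * q j
  infixl 7 _⋆_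
  _⋆_ : Series → Series → Series
  (p ⋆ q) zero    = p 0 * q 0
  (p ⋆ q) (suc n) = p 0 * q (suc n) + (shift p ⋆ q) n

  ⋆-cong-upTo : ∀ n → AgreeUpTo n p p′ → AgreeUpTo n q q′ → (p ⋆ q) n ≈ (p′ ⋆ q′) n
  ⋆-cong-upTo zero    p≈p′ q≈q′ = *-cong (p≈p′ 0 z≤n) (q≈q′ 0 z≤n)
  ⋆-cong-upTo (suc n) p≈p′ q≈q′ =
    +-cong (*-cong (p≈p′ 0 z≤n) (q≈q′ (suc n) ℕ.≤-refl))
           (⋆-cong-upTo n (λ i i≤n → p≈p′ (suc i) (s≤s i≤n))
                          (λ i i≤n → q≈q′ i (ℕ.m≤n⇒m≤1+n i≤n)))

  ⋆-congˡ : p ≋ p′ → p ⋆ q ≋ p′ ⋆ q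
  ⋆-congˡ p≈p′ n = ⋆-cong-upTo n (λ i _ → p≈p′ i) (λ _ _ → refl)

  ⋆-zeroˡ : (∀ i → p i ≈ 0#) → ∀ n → (p ⋆ q) n ≈ 0#
  ⋆-zeroˡ {q = q} p≈0 zero    = trans (*-cong (p≈0 0) refl) (zeroˡ (q 0))
  ⋆-zeroˡ {q = q} p≈0 (suc n) =
    trans (+-cong (trans (*-cong (p≈0 0) refl) (zeroˡ _)) (⋆-zeroˡ (λ i → p≈0 (suc i)) n))
          (+-identityʳ 0#)

  ⋆-identityˡ : p 0 ≈ 1# → (∀ i → p (suc i) ≈ 0#) → p ⋆ q ≋ q
  ⋆-identityˡ {q = q} p₀≈1 _    zero    = trans (*-cong p₀≈1 refl) (*-identityˡ (q 0))
  ⋆-identityˡ {q = q} p₀≈1 p₊≈0 (suc n) =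
    trans (+-cong (trans (*-cong p₀≈1 refl) (*-identityˡ _)) (⋆-zeroˡ p₊≈0 n)) (+-identityʳ _)

  ⋆-distribʳ : ∀ n p p′ q → ((λ i → p i + p′ i) ⋆ q) n ≈ (p ⋆ q) n + (p′ ⋆ q) n
  ⋆-distribʳ zero    p p′ q = distribʳ (q 0) (p 0) (p′ 0)
  ⋆-distribʳ (suc n) p p′ q =
    trans (+-cong (distribʳ (q (suc n)) (p 0) (p′ 0)) (⋆-distribʳ n (shift p) (shift p′) q))
          (interchange _ _ _ _)

  ⋆-assoc-scalar : ∀ n a p q → ((λ i → a * p i) ⋆ q) n ≈ a * (p ⋆ q) n
  ⋆-assoc-scalar zero    a p q = *-assoc a (p 0) (q 0)
  ⋆-assoc-scalar (suc n) a p q =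
    trans (+-cong (*-assoc a (p 0) (q (suc n))) (⋆-assoc-scalar n a (shift p) q))
          (sym (distribˡ a _ _))

  mulLinear-⋆ : ∀ a p q → mulLinear a p ⋆ q ≋ mulLinear a (p ⋆ q)
  mulLinear-⋆ a p q zero    = refl
  mulLinear-⋆ a p q (suc n) = begin
    p 0 * q (suc n) + ((λ i → p (suc i) + a * p i) ⋆ q) n
      ≈⟨ +-cong refl (⋆-distribʳ n (shift p) (λ i → a * p i) q) ⟩
    p 0 * q (suc n) + ((shift p ⋆ q) n + ((λ i → a * p i) ⋆ q) n)
      ≈⟨ +-cong refl (+-cong refl (⋆-assoc-scalar n a p q)) ⟩
    p 0 * q (suc n) + ((shift p ⋆ q) n + a * (p ⋆ q) n)
      ≈⟨ sym (+-assoc _ _ _) ⟩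
    (p ⋆ q) (suc n) + a * (p ⋆ q) n ∎

  -- horner p x n = Σ_{i ≤ n} p i · x^(n − i): the reversal of p 0 + … + p n · tⁿ, evaluated at x
  horner : Series → Carrier → ℕ → Carrier
  horner p x zero    = p zero
  horner p x (suc n) = x * horner p x n + p (suc n)

  horner-cong : p ≋ q → ∀ n → horner p x n ≈ horner q x n
  horner-cong p≈q zero    = p≈q zero
  horner-cong p≈q (suc n) = +-cong (*-cong refl (horner-cong p≈q n)) (p≈q (suc n))

  horner-mulLinear : ∀ d p x n → horner (mulLinear d p) x (suc n) ≈ (x + d) * horner p x n + p (suc n)
  horner-mulLinear d p x zero    = horner-linear₀ x d (p 0) (p 1)
  horner-mulLinear d p x (suc n) =
    trans (+-cong (*-cong refl (horner-mulLinear d p x n)) refl) (horner-linear x d _ _ _)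

  module Characteristic2 (char2 : 1# + 1# ≈ 0#) where

    x+x≈0 : ∀ x → x + x ≈ 0#
    x+x≈0 x = begin
      x + x             ≈⟨ +-cong (sym (*-identityʳ x)) (sym (*-identityʳ x)) ⟩
      x * 1# + x * 1#   ≈⟨ sym (distribˡ x 1# 1#) ⟩
      x * (1# + 1#)     ≈⟨ *-cong refl char2 ⟩
      x * 0#            ≈⟨ zeroʳ x ⟩
      0#                ∎

    x+y≈0⇒x≈y : ∀ {x y} → x + y ≈ 0# → x ≈ y
    x+y≈0⇒x≈y {x} {y} x+y≈0 = begin
      x             ≈⟨ sym (+-identityʳ x) ⟩
      x + 0#        ≈⟨ +-cong refl (sym (x+x≈0 y)) ⟩
      x + (y + y)   ≈⟨ sym (+-assoc x y y) ⟩
      (x + y) + y   ≈⟨ +-cong x+y≈0 refl ⟩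
      0# + y        ≈⟨ +-identityˡ y ⟩
      y             ∎

    -- (1 + a t)² = 1 + a² t²
    mulLinear²-1 : ∀ a p → mulLinear a (mulLinear a p) 1 ≈ p 1
    mulLinear²-1 a p = trans (+-assoc _ _ _) (trans (+-cong refl (x+x≈0 _)) (+-identityʳ _))

    mulLinear²-2+ : ∀ a p n → mulLinear a (mulLinear a p) (suc (suc n)) ≈ p (suc (suc n)) + a * (a * p n)
    mulLinear²-2+ a p n = begin
      (p (suc (suc n)) + a * p (suc n)) + a * (p (suc n) + a * p n)
        ≈⟨ +-cong refl (distribˡ a _ _) ⟩
      (p (suc (suc n)) + a * p (suc n)) + (a * p (suc n) + a * (a * p n))
        ≈⟨ +-shuffle _ _ _ ⟩
      (p (suc (suc n)) + a * (a * p n)) + (a * p (suc n) + a * p (suc n))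
        ≈⟨ trans (+-cong refl (x+x≈0 _)) (+-identityʳ _) ⟩
      p (suc (suc n)) + a * (a * p n) ∎

    oddVanishingUpTo-mulLinear² : ∀ {r} a p → OddVanishingUpTo r (mulLinear a (mulLinear a p)) → OddVanishingUpTo r p
    oddVanishingUpTo-mulLinear² a p odd² zero    le = trans (sym (mulLinear²-1 a p)) (odd² zero le)
    oddVanishingUpTo-mulLinear² a p odd² (suc m) le = begin
      p n+2                                  ≈⟨ sym (+-identityʳ _) ⟩
      p n+2 + 0#                             ≈⟨ +-cong refl (sym (trans (*-cong refl (zeroʳ a)) (zeroʳ a))) ⟩
      p n+2 + a * (a * 0#)                   ≈⟨ +-cong refl (*-cong refl (*-cong refl (sym p-n≈0))) ⟩
      p n+2 + a * (a * p n)                  ≈⟨ sym (mulLinear²-2+ a p n) ⟩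
      mulLinear a (mulLinear a p) n+2        ≈⟨ odd² (suc m) le ⟩
      0#                                     ∎
      where
      n = suc (double m)
      n+2 = suc (suc n)
      p-n≈0 : p n ≈ 0#
      p-n≈0 = oddVanishingUpTo-mulLinear² a p odd² m (ℕ.≤-trans (ℕ.m≤n+m n 2) le)

    horner-odd≈0 : ∀ p x → (∀ m → p (suc (double m)) ≈ x * p (double m)) → OddVanishing (horner p x)
    horner-odd≈0 p x h zero    = trans (+-cong refl (h zero)) (x+x≈0 _)
    horner-odd≈0 p x h (suc m) = begin
      x * (x * horner p x (suc (double m)) + p (double (suc m))) + p (suc (double (suc m)))
        ≈⟨ +-cong (*-cong refl (+-cong (*-cong refl (horner-odd≈0 p x h m)) refl)) (h (suc m)) ⟩
      x * (x * 0# + p (double (suc m))) + x * p (double (suc m))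
        ≈⟨ +-cong (*-cong refl (trans (+-cong (zeroʳ x) refl) (+-identityˡ _))) refl ⟩
      x * p (double (suc m)) + x * p (double (suc m))
        ≈⟨ x+x≈0 _ ⟩
      0# ∎

module FieldSeries {c ℓ} (F : FiniteField c ℓ) where
  open FiniteField F hiding (zero)
  open PowerSeries cring
  open import Relation.Binary.Reasoning.Setoid setoid
  open import Algebra.Properties.Semiring.Exp semiring using (_^_)
  open import Data.Empty using (⊥; ⊥-elim)
  open import Data.Sum using ([_,_]′)
  open import Function using (_∘_; id)
  open import Data.Product using (∃; _,_)
  open import Data.Fin using (toℕ; fromℕ<)
  open import Data.Fin.Properties using (toℕ-fromℕ<)
  open import Data.List using (List; []; _∷_; _++_; length)
  open import Data.List.Relation.Unary.All as All using (All; []; _∷_)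
  open import Data.List.Relation.Unary.Any as Any using (here; there)
  open import Data.List.Relation.Unary.AllPairs using (_∷_)
  open import Data.List.Relation.Unary.Unique.Setoid setoid using (Unique)
  open import Data.List.Relation.Binary.Pointwise as List using ([]; _∷_)
  open import Data.List.Membership.Setoid setoid using (_∈_; _∉_)
  open import Data.List.Membership.Setoid.Properties using (∈-∃++; ∈-++⁻; ∈-resp-≈; All[≉]⇒∉)
  import Data.List.Relation.Binary.Permutation.Setoid setoid as Perm
  import Data.List.Relation.Binary.Permutation.Setoid.Properties setoid as PermProps
  open Perm using (_↭_)
  open import Data.Vec.Relation.Binary.Pointwise.Inductive as Vec using (tabulate⁻)

  private
    variable
      a x : Carrier
      A D X Y : List Carrier

  x≉0⇒x*y≈0⇒y≈0 : ∀ {x y} → ¬ x ≈ 0# → x * y ≈ 0# → y ≈ 0#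
  x≉0⇒x*y≈0⇒y≈0 {x} {y} x≉0 x*y≈0 with IsField.inverse isField x x≉0
  ... | x⁻¹ , x*x⁻¹≈1 = begin
    y                ≈⟨ sym (*-identityˡ y) ⟩
    1# * y           ≈⟨ *-cong (trans (sym x*x⁻¹≈1) (*-comm x x⁻¹)) refl ⟩
    (x⁻¹ * x) * y    ≈⟨ *-assoc x⁻¹ x y ⟩
    x⁻¹ * (x * y)    ≈⟨ *-cong refl x*y≈0 ⟩
    x⁻¹ * 0#         ≈⟨ zeroʳ x⁻¹ ⟩
    0#               ∎

  x≉0⇒x^n*y≈0⇒y≈0 : ∀ {x y} → ¬ x ≈ 0# → ∀ n → x ^ n * y ≈ 0# → y ≈ 0#
  x≉0⇒x^n*y≈0⇒y≈0 {y = y} _   zero    1*y≈0 = trans (sym (*-identityˡ y)) 1*y≈0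
  x≉0⇒x^n*y≈0⇒y≈0         x≉0 (suc n) x^n+1*y≈0 =
    x≉0⇒x^n*y≈0⇒y≈0 x≉0 n (x≉0⇒x*y≈0⇒y≈0 x≉0 (trans (sym (*-assoc _ _ _)) x^n+1*y≈0))

  eSeries : List Carrier → Series
  eSeries X i = e F i X

  eSeries-∷ : ∀ x X → eSeries (x ∷ X) ≋ mulLinear x (eSeries X)
  eSeries-∷ x X zero    = refl
  eSeries-∷ x X (suc n) = refl

  eSeries-∷-cong : ∀ {x y X Y} → x ≈ y → eSeries X ≋ eSeries Y → eSeries (x ∷ X) ≋ eSeries (y ∷ Y)
  eSeries-∷-cong x≈y X≈Y zero    = refl
  eSeries-∷-cong x≈y X≈Y (suc n) = mulLinear-cong x≈y X≈Y (suc n)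

  eSeries-∷∷ : ∀ x y X → eSeries (x ∷ y ∷ X) ≋ mulLinear x (mulLinear y (eSeries X))
  eSeries-∷∷ x y X n = trans (eSeries-∷ x (y ∷ X) n) (mulLinear-cong refl (eSeries-∷ y X) n)

  eSeries-swap : ∀ x y X → eSeries (x ∷ y ∷ X) ≋ eSeries (y ∷ x ∷ X)
  eSeries-swap x y X n = begin
    eSeries (x ∷ y ∷ X) n                         ≈⟨ eSeries-∷∷ x y X n ⟩
    mulLinear x (mulLinear y (eSeries X)) n       ≈⟨ mulLinear-comm x y (eSeries X) n ⟩
    mulLinear y (mulLinear x (eSeries X)) n       ≈⟨ sym (eSeries-∷∷ y x X n) ⟩
    eSeries (y ∷ x ∷ X) n                         ∎

  e-beyond-length : ∀ X {n} → length X < n → e F n X ≈ 0#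
  e-beyond-length []      {suc n} _          = refl
  e-beyond-length (x ∷ X) {suc n} (s≤s |X|<n) =
    trans (+-cong (e-beyond-length X (ℕ.m<n⇒m<1+n |X|<n))
                  (trans (*-cong refl (e-beyond-length X |X|<n)) (zeroʳ x)))
          (+-identityʳ 0#)

  eSeries-resp-pointwise : List.Pointwise _≈_ X Y → eSeries X ≋ eSeries Y
  eSeries-resp-pointwise []            n = refl
  eSeries-resp-pointwise (x≈y ∷ X≈Y) n = eSeries-∷-cong x≈y (eSeries-resp-pointwise X≈Y) n

  eSeries-resp-↭ : X ↭ Y → eSeries X ≋ eSeries Y
  eSeries-resp-↭ (Perm.refl X≈Y)        = eSeries-resp-pointwise X≈Y
  eSeries-resp-↭ (Perm.prep x≈y X↭Y)    = eSeries-∷-cong x≈y (eSeries-resp-↭ X↭Y)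
  eSeries-resp-↭ (Perm.swap {xs = X} {x = x} {y = y} x≈x′ y≈y′ X↭Y) n =
    trans (eSeries-swap x y X n) (eSeries-∷-cong y≈y′ (eSeries-∷-cong x≈x′ (eSeries-resp-↭ X↭Y)) n)
  eSeries-resp-↭ (Perm.trans X↭Y Y↭Z) n = trans (eSeries-resp-↭ X↭Y n) (eSeries-resp-↭ Y↭Z n)

  eSeries-++ : ∀ Y Z → eSeries (Y ++ Z) ≋ eSeries Y ⋆ eSeries Z
  eSeries-++ []      Z n = sym (⋆-identityˡ refl (λ _ → refl) n)
  eSeries-++ (y ∷ Y) Z n = begin
    eSeries (y ∷ Y ++ Z) n                   ≈⟨ eSeries-∷ y (Y ++ Z) n ⟩
    mulLinear y (eSeries (Y ++ Z)) n         ≈⟨ mulLinear-cong refl (eSeries-++ Y Z) n ⟩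
    mulLinear y (eSeries Y ⋆ eSeries Z) n    ≈⟨ sym (mulLinear-⋆ y (eSeries Y) (eSeries Z) n) ⟩
    (mulLinear y (eSeries Y) ⋆ eSeries Z) n  ≈⟨ ⋆-congˡ (λ i → sym (eSeries-∷ y Y i)) n ⟩
    (eSeries (y ∷ Y) ⋆ eSeries Z) n          ∎

  eSeries-++-agreeUpTo : ∀ {n} Y Y′ Z Z′ → AgreeUpTo n (eSeries Y) (eSeries Y′) →
                         AgreeUpTo n (eSeries Z) (eSeries Z′) →
                         AgreeUpTo n (eSeries (Y ++ Z)) (eSeries (Y′ ++ Z′))
  eSeries-++-agreeUpTo Y Y′ Z Z′ Y≈Y′ Z≈Z′ i i≤n = begin
    eSeries (Y ++ Z) i          ≈⟨ eSeries-++ Y Z i ⟩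
    (eSeries Y ⋆ eSeries Z) i   ≈⟨ ⋆-cong-upTo i (below Y≈Y′) (below Z≈Z′) ⟩
    (eSeries Y′ ⋆ eSeries Z′) i ≈⟨ sym (eSeries-++ Y′ Z′ i) ⟩
    eSeries (Y′ ++ Z′) i        ∎
    where
    below : ∀ {p q} → AgreeUpTo _ p q → AgreeUpTo i p q
    below p≈q j j≤i = p≈q j (ℕ.≤-trans j≤i i≤n)

  f-pointwise⇒agreeUpTo : ∀ {r} A B → Vec.Pointwise _≈_ (f F r A) (f F r B) →
                          AgreeUpTo r (eSeries A) (eSeries B)
  f-pointwise⇒agreeUpTo A B fA≈fB zero    _   = refl
  f-pointwise⇒agreeUpTo A B fA≈fB (suc j) j<r =
    ≡.subst (λ i → e F (suc i) A ≈ e F (suc i) B) (toℕ-fromℕ< j<r) (tabulate⁻ fA≈fB (fromℕ< j<r))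

  ∈⇒↭∷ : a ∈ X → ∃ λ X′ → X ↭ a ∷ X′
  ∈⇒↭∷ a∈X with ∈-∃++ setoid a∈X
  ... | ys , zs , w , a≈w , X≋ys++w∷zs =
    ys ++ zs , Perm.trans (Perm.refl X≋ys++w∷zs) (PermProps.shift (sym a≈w) ys zs)

  ↭-++-complement : ∀ A → Unique A → All (_∈ X) A → ∃ λ R → X ↭ A ++ R
  ↭-++-complement {X} []      _            _            = X , Perm.↭-refl
  ↭-++-complement     (a ∷ A) (a≉A ∷ uA) (a∈X ∷ A⊆X) with ∈⇒↭∷ a∈X
  ... | X′ , X↭a∷X′ with ↭-++-complement A uA (All.zipWith (λ (a≉b , b∈X) →
        Any.tail (a≉b ∘ sym) (PermProps.∈-resp-↭ X↭a∷X′ b∈X)) (a≉A , A⊆X))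
  ... | R , X′↭A++R = R , Perm.trans X↭a∷X′ (Perm.↭-prep a X′↭A++R)

  ∉-sym : ∀ {B} → All (_∉ B) A → All (_∉ A) B
  ∉-sym A∉B = All.tabulateₛ setoid λ b∈B b∈A →
    All.lookupWith {R = λ _ → ⊥} (λ a∉B b≈a → a∉B (∈-resp-≈ setoid b≈a b∈B)) A∉B b∈A

  ↭-++-++-complement : ∀ A B → Unique A → Unique B → All (_∈ X) A → All (_∈ X) B → All (_∉ B) A →
                       ∃ λ C → X ↭ A ++ B ++ C
  ↭-++-++-complement A B uA uB A⊆X B⊆X A∉B with ↭-++-complement A uA A⊆X
  ... | R , X↭A++R with ↭-++-complement B uB (All.zipWith (λ (b∈X , b∉A) →
        [ ⊥-elim ∘ b∉A , id ]′ (∈-++⁻ setoid A (PermProps.∈-resp-↭ X↭A++R b∈X))) (B⊆X , ∉-sym A∉B))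
  ... | C , R↭B++C = C , Perm.trans X↭A++R (PermProps.++⁺ˡ A R↭B++C)

  Unique-++⁻ʳ : ∀ X → Unique (X ++ Y) → Unique Y
  Unique-++⁻ʳ []      u       = u
  Unique-++⁻ʳ (x ∷ X) (_ ∷ u) = Unique-++⁻ʳ X u

  -- ∏_{d ∈ D} (x + d); in characteristic 2 this is ∏_{d ∈ D} (x − d)
  rootPoly : List Carrier → Carrier → Carrier
  rootPoly []      x = 1#
  rootPoly (d ∷ D) x = (x + d) * rootPoly D x

  horner-eSeries : ∀ D x → horner (eSeries D) x (length D) ≈ rootPoly D x
  horner-eSeries []      x = refl
  horner-eSeries (d ∷ D) x = begin
    horner (eSeries (d ∷ D)) x (suc (length D))
      ≈⟨ horner-cong (eSeries-∷ d D) (suc (length D)) ⟩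
    horner (mulLinear d (eSeries D)) x (suc (length D))
      ≈⟨ horner-mulLinear d (eSeries D) x (length D) ⟩
    (x + d) * horner (eSeries D) x (length D) + e F (suc (length D)) D
      ≈⟨ +-cong (*-cong refl (horner-eSeries D x)) (e-beyond-length D ℕ.≤-refl) ⟩
    rootPoly (d ∷ D) x + 0#
      ≈⟨ +-identityʳ _ ⟩
    rootPoly (d ∷ D) x ∎

  horner-eSeries-+ : ∀ j D x → horner (eSeries D) x (j ℕ.+ length D) ≈ x ^ j * rootPoly D x
  horner-eSeries-+ zero    D x = trans (horner-eSeries D x) (sym (*-identityˡ _))
  horner-eSeries-+ (suc j) D x = begin
    x * horner (eSeries D) x (j ℕ.+ length D) + e F (suc (j ℕ.+ length D)) D
      ≈⟨ +-cong (*-cong refl (horner-eSeries-+ j D x))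
                (e-beyond-length D (s≤s (ℕ.m≤n+m (length D) j))) ⟩
    x * (x ^ j * rootPoly D x) + 0#
      ≈⟨ trans (+-identityʳ _) (sym (*-assoc x (x ^ j) (rootPoly D x))) ⟩
    x ^ suc j * rootPoly D x ∎

  oddVanishingUpTo-length : ∀ C → OddVanishingUpTo (length C) (eSeries C) → OddVanishing (eSeries C)
  oddVanishingUpTo-length C odd m with suc (double m) ≤? length C
  ... | yes le = odd m le
  ... | no  gt = e-beyond-length C (ℕ.≰⇒> gt)

  module _ (char2 : HasChar2 F) where
    open Characteristic2 char2

    rootPoly≈0⇒∈ : ∀ D → rootPoly D x ≈ 0# → x ∈ D
    rootPoly≈0⇒∈ []      1≈0 = ⊥-elim (IsField.1≉0 isField 1≈0)
    rootPoly≈0⇒∈ {x} (d ∷ D) P≈0 with (x + d) ≟ 0#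
    ... | yes x+d≈0 = here (x+y≈0⇒x≈y x+d≈0)
    ... | no  x+d≉0 = there (rootPoly≈0⇒∈ D (x≉0⇒x*y≈0⇒y≈0 x+d≉0 P≈0))

    -- Vanishing of the odd coefficients of (1 + x t) · e(D) says e_{2m+1}(D) = x e_{2m}(D), so the
    -- reversal of e(D) as a polynomial of odd degree 2|D| + 1, namely x^(|D|+1) ∏_{d ∈ D} (x + d),
    -- vanishes at x.
    ¬oddVanishing-∷ : ¬ x ≈ 0# → x ∉ D → ¬ OddVanishing (eSeries (x ∷ D))
    ¬oddVanishing-∷ {x} {D} x≉0 x∉D odd =
      x∉D (rootPoly≈0⇒∈ D (x≉0⇒x^n*y≈0⇒y≈0 x≉0 (suc (length D)) x^|D|+1*P≈0))
      where
      x^|D|+1*P≈0 : x ^ suc (length D) * rootPoly D x ≈ 0#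
      x^|D|+1*P≈0 = begin
        x ^ suc (length D) * rootPoly D x
          ≈⟨ sym (horner-eSeries-+ (suc (length D)) D x) ⟩
        horner (eSeries D) x (suc (length D ℕ.+ length D))
          ≡⟨ ≡.cong (horner (eSeries D) x ∘ suc) (≡.sym (double≡n+n (length D))) ⟩
        horner (eSeries D) x (suc (double (length D)))
          ≈⟨ horner-odd≈0 (eSeries D) x (λ m → x+y≈0⇒x≈y (odd m)) (length D) ⟩
        0# ∎

    unique⇒¬oddVanishing : ∀ C → Unique C → 2 ≤ length C → ¬ OddVanishing (eSeries C)
    unique⇒¬oddVanishing (x ∷ []) _ (s≤s ())
    unique⇒¬oddVanishing (x ∷ y ∷ C) ((x≉y ∷ x≉C) ∷ y≉C ∷ _) _ odd with x ≟ 0#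
    ... | no  x≉0 = ¬oddVanishing-∷ x≉0 (All[≉]⇒∉ setoid (x≉y ∷ x≉C)) odd
    ... | yes x≈0 = ¬oddVanishing-∷ (λ y≈0 → x≉y (trans x≈0 (sym y≈0)))
                                    (All[≉]⇒∉ setoid ((x≉y ∘ sym) ∷ y≉C))
                                    (λ m → trans (eSeries-swap y x C (suc (double m))) (odd m))

    oddVanishingUpTo-++-self : ∀ {r} A C → OddVanishingUpTo r (eSeries (A ++ A ++ C)) →
                               OddVanishingUpTo r (eSeries C)
    oddVanishingUpTo-++-self []      C odd = odd
    oddVanishingUpTo-++-self (a ∷ A) C odd =
      oddVanishingUpTo-++-self A C
        (oddVanishingUpTo-mulLinear² a (eSeries (A ++ A ++ C)) (oddVanishingUpTo-resp regroup odd))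
      where
      regroup : AgreeUpTo _ (eSeries (a ∷ A ++ a ∷ A ++ C)) (mulLinear a (mulLinear a (eSeries (A ++ A ++ C))))
      regroup i _ = trans (eSeries-resp-↭ (Perm.↭-prep a (PermProps.↭-shift A (A ++ C))) i)
                          (eSeries-∷∷ a a (A ++ A ++ C) i)


    ¬oddVanishingUpTo-++-++ : ∀ {r} A B C → length C ≡ r → 2 ≤ r → Unique C →
                              AgreeUpTo r (eSeries A) (eSeries B) →
                              ¬ OddVanishingUpTo r (eSeries (A ++ B ++ C))
    ¬oddVanishingUpTo-++-++ A B C ≡.refl 2≤|C| uC A≈B odd =
      unique⇒¬oddVanishing C uC 2≤|C| (oddVanishingUpTo-length C oddC)
      where
      A++B++C≈A++A++C : AgreeUpTo (length C) (eSeries (A ++ B ++ C)) (eSeries (A ++ A ++ C))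
      A++B++C≈A++A++C = eSeries-++-agreeUpTo A A (B ++ C) (A ++ C) (λ _ _ → refl)
        (eSeries-++-agreeUpTo B A C C (λ i i≤r → sym (A≈B i i≤r)) (λ _ _ → refl))

      oddC : OddVanishingUpTo (length C) (eSeries C)
      oddC = oddVanishingUpTo-++-self A C (oddVanishingUpTo-resp A++B++C≈A++A++C odd)

open import Data.Nat using (_+_; _*_)
open import Data.List using (List; length; _++_)
open import Data.List.Properties using (length-++)
open import Data.List.Relation.Unary.All using (All)
open import Data.Vec.Relation.Binary.Pointwise.Inductive using (Pointwise)
open import Data.List.Membership.Setoid using (_∈_; _∉_)
open import Data.List.Relation.Unary.Unique.Setoid using (Unique)
open import Data.List.Relation.Binary.Permutation.Setoid.Properties using (xs↭ys⇒|xs|≡|ys|; Unique-resp-↭)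
open import Data.Nat.Tactic.RingSolver as ℕ-Solver using ()
open import Data.Product using (_,_)

k+[k+n]≡2k+r⇒n≡r : ∀ k n r → k + (k + n) ≡ 2 * k + r → n ≡ r
k+[k+n]≡2k+r⇒n≡r k n r eq = ℕ.+-cancelˡ-≡ (2 * k) n r (≡.trans (regroup k n) eq)
  where
  regroup : ∀ k n → 2 * k + n ≡ k + (k + n)
  regroup = ℕ-Solver.solve-∀

lemma3p1 : ∀ {c ℓ : Level} (F : FiniteField c ℓ) → HasChar2 F →
    (k r : ℕ) → 1 ≤ k → 2 ≤ r →
    (X : List (FiniteField.Carrier F)) → Unique (FiniteField.setoid F) X →
    length X ≡ 2 * k + r →
    (∀ m → 2 * m + 1 ≤ r → FiniteField._≈_ F (e F (2 * m + 1) X) (FiniteField.0# F)) →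
    (A B : List (FiniteField.Carrier F)) →
    Unique (FiniteField.setoid F) A → Unique (FiniteField.setoid F) B →
    All (λ a → _∈_ (FiniteField.setoid F) a X) A →
    All (λ b → _∈_ (FiniteField.setoid F) b X) B →
    All (λ a → _∉_ (FiniteField.setoid F) a B) A →
    length A ≡ k → length B ≡ k →
    ¬ Pointwise (FiniteField._≈_ F) (f F r A) (f F r B)
lemma3p1 F char2 k r _ 2≤r X uX |X|≡2k+r oddX A B uA uB A⊆X B⊆X A∉B |A|≡k |B|≡k fA≈fB
  with FieldSeries.↭-++-++-complement F A B uA uB A⊆X B⊆X A∉B
... | C , X↭A++B++C =
  ¬oddVanishingUpTo-++-++ char2 A B C |C|≡r 2≤r uC (f-pointwise⇒agreeUpTo A B fA≈fB)
    (oddVanishingUpTo-resp (λ i _ → eSeries-resp-↭ X↭A++B++C i) (oddVanishingUpTo-2*+1 {p = eSeries X} oddX))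
  where
  open FiniteField F using (setoid)
  open PowerSeries (FiniteField.cring F)
  open FieldSeries F

  |C|≡r : length C ≡ r
  |C|≡r = k+[k+n]≡2k+r⇒n≡r k (length C) r (begin
    k + (k + length C)                ≡⟨ ≡.cong₂ (λ a b → a + (b + length C)) (≡.sym |A|≡k) (≡.sym |B|≡k) ⟩
    length A + (length B + length C)  ≡⟨ ≡.sym (≡.trans (length-++ A) (≡.cong (length A +_) (length-++ B))) ⟩
    length (A ++ B ++ C)              ≡⟨ ≡.sym (xs↭ys⇒|xs|≡|ys| setoid X↭A++B++C) ⟩
    length X                          ≡⟨ |X|≡2k+r ⟩
    2 * k + r                         ∎)
    where open ≡.≡-Reasoning

  uC : Unique setoid C
  uC = Unique-++⁻ʳ B (Unique-++⁻ʳ A (Unique-resp-↭ setoid X↭A++B++C uX))
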